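{- Let $P,Q,R$ be parts of a system $S$, and $\phi$ a constraint on $P$. Then: (1) For every $a\in B_{Q\cap R}$: $\Diamond^P_{Q\cap R}\phi(a)$ holds iff there exist $q\in B_Q$, $r\in B_R$ with $\mathfrak{c}(q,r)$, $q|_{Q\cap R}=a$, and $\Diamond^P_{Q\cup R}\phi(q,r)$. (2) For all compatible $q\in B_Q$, $r\in B_R$ (so $(q,r)\in B_{Q\cup R}$): $\Diamond^P_{Q\cup R}\phi(q,r)\vdash\Diamond^P_Q\phi(q)\wedge\Diamond^P_R\phi(r)$. (3) For every $a\in B_{Q\cap R}$: $\Box^P_{Q\cap R}\phi(a)$ holds iff for all $q\in B_Q$, $r\in B_R$ with $\mathfrak{c}(q,r)$ and $q|_{Q\cap R}=a$, $\Box^P_{Q\cup R}\phi(q,r)$ holds. (4) For all compatible $q\in B_Q$, $r\in B_R$: $\Box^P_Q\phi(q)\vee\Box^P_R\phi(r)\vdash\Box^P_{Q\cup R}\phi(q,r)$.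
   Context: A system $S$ is modeled by a set $B_S$ of possible behaviors. A part $P$ of $S$ is a surjective function $|_P\colon B_S\to B_P$; write $s|_P$ for its value. $P\ge Q$ means there is a map $B_P\to B_Q$ (also written $p\mapsto p|_Q$) compatible with the restrictions from $B_S$. Compatibility: $\mathfrak{c}(a,b)$ for $a\in B_Q,b\in B_R$ iff some $s\in B_S$ has $s|_Q=a$, $s|_R=b$. The join $Q\cup R$ has $B_{Q\cup R}=\{(q,r)\in B_Q\times B_R\mid\mathfrak{c}(q,r)\}$ with $s|_{Q\cup R}=(s|_Q,s|_R)$. The meet $Q\cap R$ has $B_{Q\cap R}$ the pushout of $B_Q\twoheadleftarrow B_S\twoheadrightarrow B_R$, with the induced maps $q\mapsto q|_{Q\cap R}$, $r\mapsto r|_{Q\cap R}$ and $s|_{Q\cap R}$. A constraint on $P$ is a predicate $B_P\to\{\mathtt{true},\mathtt{false}\}$. Allowance: $\Diamond^P_X\phi(x)=\exists s\in B_S.\,(s|_X=x)\wedge\phi(s|_P)$. Ensurance: $\Box^P_X\phi(x)=\forall s\in B_S.\,(s|_X=x)\Rightarrow\phi(s|_P)$. -}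

module Defs where

open import Data.Bool using (Bool; true)
open import Data.Product using (Σ; ∃; _×_; _,_; proj₁)
open import Data.Sum using (_⊎_; inj₁; inj₂)
open import Relation.Binary.PropositionalEquality using (_≡_; refl)
open import Relation.Binary.Construct.Closure.Equivalence using (EqClosure)

record Part (BS : Set) : Set₁ where
  field
    B    : Set
    res  : BS → B
    surj : ∀ (b : B) → ∃ λ s → res s ≡ b

open Part public

-- A "restriction view": a behaviour set given together with its notion of
-- equality (needed because the meet is a quotient, represented as a setoid)
-- and the restriction map from BS.
record View (BS : Set) : Set₁ where
  field
    Carrier : Set
    _≈_     : Carrier → Carrier → Set
    resV    : BS → Carrier

open View public

module _ {BS : Set} where

  ⌊_⌋ : Part BS → View BS
  ⌊ P ⌋ = record { Carrier = B P ; _≈_ = _≡_ ; resV = res P }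

  Compat : (Q R : Part BS) → B Q → B R → Set
  Compat Q R q r = ∃ λ s → res Q s ≡ q × res R s ≡ r

  JoinB : (Q R : Part BS) → Set
  JoinB Q R = Σ (B Q × B R) λ qr → Compat Q R (proj₁ qr) (Data.Product.proj₂ qr)

  _∪_ : Part BS → Part BS → View BS
  Q ∪ R = record
    { Carrier = JoinB Q R
    ; _≈_     = λ x y → proj₁ x ≡ proj₁ y
    ; resV    = λ s → ((res Q s , res R s) , s , refl , refl)
    }

  -- Meet: the pushout of B_Q ↞ B_S ↠ B_R in Set, constructed as usual as
  -- (B_Q ⊎ B_R) modulo the equivalence relation generated by s|_Q ~ s|_R.
  data Glue (Q R : Part BS) : B Q ⊎ B R → B Q ⊎ B R → Set where
    glue : ∀ s → Glue Q R (inj₁ (res Q s)) (inj₂ (res R s))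

  _∩_ : Part BS → Part BS → View BS
  Q ∩ R = record
    { Carrier = B Q ⊎ B R
    ; _≈_     = EqClosure (Glue Q R)
    ; resV    = λ s → inj₁ (res Q s)
    }

  toMeetˡ : (Q R : Part BS) → B Q → Carrier (Q ∩ R)
  toMeetˡ Q R q = inj₁ q

  toMeetʳ : (Q R : Part BS) → B R → Carrier (Q ∩ R)
  toMeetʳ Q R r = inj₂ r

  ◇ : (P : Part BS) (X : View BS) → (B P → Bool) → Carrier X → Set
  ◇ P X φ x = ∃ λ s → _≈_ X (resV X s) x × φ (res P s) ≡ true

  □ : (P : Part BS) (X : View BS) → (B P → Bool) → Carrier X → Set
  □ P X φ x = ∀ s → _≈_ X (resV X s) x → φ (res P s) ≡ true

module Submission where

-- The whole theorem rests on one notion, the refinement order X ≥ Y of the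
-- paper: a map x ↦ x|_Y from the behaviours of X to those of Y that respects
-- equality and commutes with the restrictions from B_S.  For any such pair:
--   * allowance pushes forward:  ◇_Y φ y  ⇔  ∃ x. x|_Y ≈ y ∧ ◇_X φ x,
--   * ensurance pulls back:      □_Y φ y  ⇔  ∀ x. x|_Y ≈ y ⇒ □_X φ x,
-- and, specialising y to x|_Y, allowance is monotone (◇_X φ x ⊢ ◇_Y φ (x|_Y))
-- and ensurance antitone (□_Y φ (x|_Y) ⊢ □_X φ x).
-- We then exhibit three refinements out of the join, Q ∪ R ≥ Q, Q ∪ R ≥ R
-- (the two projections) and Q ∪ R ≥ Q ∩ R (via q ↦ q|_{Q∩R}).  Parts (1) and
-- (3) of the theorem are pushforward and pullback along Q ∪ R ≥ Q ∩ R, with the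
-- join behaviour ((q , r) , c) uncurried; parts (2) and (4) are monotonicity
-- and antitonicity along the two projections.

open import Defs
open import Data.Bool using (Bool)
open import Data.Product using (∃; Σ; _×_; _,_; proj₁; proj₂)
open import Data.Sum using (_⊎_; inj₁; inj₂)
open import Function.Bundles using (_⇔_; mk⇔; Equivalence)
open import Relation.Binary.Structures using (IsEquivalence)
open import Relation.Binary.PropositionalEquality using (_≡_; refl; cong)
import Relation.Binary.PropositionalEquality.Properties as ≡
import Relation.Binary.Construct.Closure.Equivalence as EqClosure

module _ {BS : Set} where

  record _≥_ (X Y : View BS) : Set where
    field
      restrict      : Carrier X → Carrier Y
      restrict-cong : ∀ {x x′} → _≈_ X x x′ → _≈_ Y (restrict x) (restrict x′)
      restrict-res  : ∀ s → _≈_ Y (restrict (resV X s)) (resV Y s)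

  open _≥_ public

  module _ {X Y : View BS} (X≥Y : X ≥ Y) (Y-equiv : IsEquivalence (_≈_ Y)) where
    open IsEquivalence Y-equiv renaming (sym to symʸ; trans to transʸ)

    restrict-along : ∀ s {x} → _≈_ X (resV X s) x →
                     _≈_ Y (resV Y s) (restrict X≥Y x)
    restrict-along s s≈x =
      transʸ (symʸ (restrict-res X≥Y s)) (restrict-cong X≥Y s≈x)

    ◇-pushforward : (∀ x → _≈_ X x x) → (P : Part BS) (φ : B P → Bool) →
      ∀ y → ◇ P Y φ y ⇔ (∃ λ x → _≈_ Y (restrict X≥Y x) y × ◇ P X φ x)
    ◇-pushforward reflˣ P φ y = mk⇔
      (λ { (s , s≈y , φs) →
             resV X s , transʸ (restrict-res X≥Y s) s≈y , s , reflˣ (resV X s) , φs })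
      (λ { (x , x≈y , s , s≈x , φs) →
             s , transʸ (restrict-along s s≈x) x≈y , φs })

    □-pullback : (∀ x → _≈_ X x x) → (P : Part BS) (φ : B P → Bool) →
      ∀ y → □ P Y φ y ⇔ (∀ x → _≈_ Y (restrict X≥Y x) y → □ P X φ x)
    □-pullback reflˣ P φ y = mk⇔
      (λ H x x≈y s s≈x → H s (transʸ (restrict-along s s≈x) x≈y))
      (λ H s s≈y → H (resV X s) (transʸ (restrict-res X≥Y s) s≈y) s (reflˣ (resV X s)))

    ◇-mono : (P : Part BS) (φ : B P → Bool) →
      ∀ x → ◇ P X φ x → ◇ P Y φ (restrict X≥Y x)
    ◇-mono P φ x (s , s≈x , φs) = s , restrict-along s s≈x , φs

    □-antitone : (P : Part BS) (φ : B P → Bool) →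
      ∀ x → □ P Y φ (restrict X≥Y x) → □ P X φ x
    □-antitone P φ x H s s≈x = H s (restrict-along s s≈x)

  module _ (Q R : Part BS) where

    ∪-refl : ∀ x → _≈_ (Q ∪ R) x x
    ∪-refl x = refl

    ∩-equiv : IsEquivalence (_≈_ (Q ∩ R))
    ∩-equiv = EqClosure.isEquivalence (Glue Q R)

    ∪≥ˡ : (Q ∪ R) ≥ ⌊ Q ⌋
    ∪≥ˡ = record
      { restrict      = λ x → proj₁ (proj₁ x)
      ; restrict-cong = cong proj₁
      ; restrict-res  = λ s → refl
      }

    ∪≥ʳ : (Q ∪ R) ≥ ⌊ R ⌋
    ∪≥ʳ = record
      { restrict      = λ x → proj₂ (proj₁ x)
      ; restrict-cong = cong proj₂
      ; restrict-res  = λ s → refl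
      }

    ∪≥∩ : (Q ∪ R) ≥ (Q ∩ R)
    ∪≥∩ = record
      { restrict      = λ x → toMeetˡ Q R (proj₁ (proj₁ x))
      ; restrict-cong = λ x≡x′ → meet-cong (cong proj₁ x≡x′)
      ; restrict-res  = λ s → IsEquivalence.refl ∩-equiv
      }
      where
      meet-cong : ∀ {q q′} → q ≡ q′ → _≈_ (Q ∩ R) (toMeetˡ Q R q) (toMeetˡ Q R q′)
      meet-cong refl = IsEquivalence.refl ∩-equiv

  module _ (P Q R : Part BS) (φ : B P → Bool) where

    ◇-meet : ∀ a → ◇ P (Q ∩ R) φ a ⇔
      (∃ λ q → ∃ λ r → Σ (Compat Q R q r) λ c →
        _≈_ (Q ∩ R) (toMeetˡ Q R q) a × ◇ P (Q ∪ R) φ ((q , r) , c))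
    ◇-meet a = mk⇔
      (λ h → let (((q , r) , c) , rest) = to h in q , r , c , rest)
      (λ { (q , r , c , rest) → from (((q , r) , c) , rest) })
      where open Equivalence (◇-pushforward (∪≥∩ Q R) (∩-equiv Q R) (∪-refl Q R) P φ a)

    ◇-join : ∀ q r c → ◇ P (Q ∪ R) φ ((q , r) , c) → ◇ P ⌊ Q ⌋ φ q × ◇ P ⌊ R ⌋ φ r
    ◇-join q r c h = ◇-mono (∪≥ˡ Q R) ≡.isEquivalence P φ ((q , r) , c) h
                   , ◇-mono (∪≥ʳ Q R) ≡.isEquivalence P φ ((q , r) , c) h

    □-meet : ∀ a → □ P (Q ∩ R) φ a ⇔
      (∀ q r (c : Compat Q R q r) →
        _≈_ (Q ∩ R) (toMeetˡ Q R q) a → □ P (Q ∪ R) φ ((q , r) , c))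
    □-meet a = mk⇔
      (λ H q r c → to H ((q , r) , c))
      (λ H → from (λ { ((q , r) , c) → H q r c }))
      where open Equivalence (□-pullback (∪≥∩ Q R) (∩-equiv Q R) (∪-refl Q R) P φ a)

    □-join : ∀ q r c → □ P ⌊ Q ⌋ φ q ⊎ □ P ⌊ R ⌋ φ r → □ P (Q ∪ R) φ ((q , r) , c)
    □-join q r c (inj₁ H) = □-antitone (∪≥ˡ Q R) ≡.isEquivalence P φ ((q , r) , c) H
    □-join q r c (inj₂ H) = □-antitone (∪≥ʳ Q R) ≡.isEquivalence P φ ((q , r) , c) H

mainTheorem7 : {BS : Set} (P Q R : Part BS) (φ : B P → Bool) →
    (∀ (a : Carrier (Q ∩ R)) →
    ◇ P (Q ∩ R) φ a ⇔
    (∃ λ (q : B Q) → ∃ λ (r : B R) → Σ (Compat Q R q r) λ c →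
    _≈_ (Q ∩ R) (toMeetˡ Q R q) a × ◇ P (Q ∪ R) φ ((q , r) , c)))
    × (∀ (q : B Q) (r : B R) (c : Compat Q R q r) →
    ◇ P (Q ∪ R) φ ((q , r) , c) → ◇ P ⌊ Q ⌋ φ q × ◇ P ⌊ R ⌋ φ r)
    × (∀ (a : Carrier (Q ∩ R)) →
    □ P (Q ∩ R) φ a ⇔
    (∀ (q : B Q) (r : B R) (c : Compat Q R q r) →
    _≈_ (Q ∩ R) (toMeetˡ Q R q) a → □ P (Q ∪ R) φ ((q , r) , c)))
    × (∀ (q : B Q) (r : B R) (c : Compat Q R q r) →
    □ P ⌊ Q ⌋ φ q ⊎ □ P ⌊ R ⌋ φ r → □ P (Q ∪ R) φ ((q , r) , c))
mainTheorem7 P Q R φ = ◇-meet P Q R φ , ◇-join P Q R φ , □-meet P Q R φ , □-join P Q R φ
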